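{- Let $T$ be a tournament and $R$ a minimal $\tau$-retentive set of $T$ such that the domination graph of $T[R]$ is not empty. Let there be an arc from $v$ to $u$ in the directed domination graph $\vec{D}(T[R])$. Then no vertex of $T$ dominates both $v$ and $u$.
   Context: A tournament $T$ consists of a finite vertex set $V(T)$ and an asymmetric, complete binary relation $\succ$ on $V(T)$ ($x$ dominates $y$ if $x\succ y$). For $v\in V(T)$ let $N^-_T(v)=\{u: u\succ v\}$; for $B\subseteq V(T)$, $T[B]$ is the induced subtournament. In a tournament $S$, $v$ is the captain of $u$ if $v\succ u$ and $v\succ w$ for every $w\in N^-_S(u)\setminus\{v\}$. The directed domination graph $\vec{D}(S)$ has vertex set $V(S)$ and an arc from $v$ to $u$ iff $v$ is the captain of $u$ in $S$; the (undirected) domination graph is its underlying undirected graph, and it is empty if it has no edge. The tournament equilibrium set $\tau$ is defined recursively: a nonempty $A\subseteq V(T)$ is $\tau$-retentive if for every $x\in A$ with $N^-_T(x)\neq\emptyset$, $\tau(T[N^-_T(x)])\subseteq A$; $A$ is a minimal $\tau$-retentive set if no $\tau$-retentive set of $T$ is a proper subset of $A$; $\tau(T)$ is the union of all minimal $\tau$-retentive sets of $T$. -}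

module Defs where

open import Data.Nat using (ℕ; zero; suc)
open import Data.Fin using (Fin)
open import Data.Fin.Subset using (Subset; _∈_; _∉_; _⊆_; _⊂_; Nonempty; ⊤)
open import Data.Fin.Subset.Properties using (_∈?_)
open import Data.Bool using (_∧_)
open import Data.Vec using (tabulate)
open import Data.Product using (_×_; ∃; ∃-syntax)
open import Data.Sum using (_⊎_)
open import Data.Empty using (⊥)
open import Relation.Nullary using (¬_)
open import Relation.Nullary.Decidable using (⌊_⌋)
open import Relation.Binary using (Decidable)
open import Relation.Binary.PropositionalEquality using (_≡_; _≢_)

record Tournament (n : ℕ) : Set₁ where
  field
    _≻_      : Fin n → Fin n → Set
    ≻-dec    : Decidable _≻_
    asym     : ∀ {x y} → x ≻ y → ¬ (y ≻ x)
    complete : ∀ {x y} → x ≢ y → (x ≻ y) ⊎ (y ≻ x)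

module _ {n : ℕ} (T : Tournament n) where
  open Tournament T

  -- Subtournaments T[B] are represented by their vertex sets B ⊆ V(T).
  -- N⁻_{T[B]}(y) = { z ∈ B : z ≻ y }
  inNbr : Subset n → Fin n → Subset n
  inNbr B y = tabulate (λ z → ⌊ z ∈? B ⌋ ∧ ⌊ ≻-dec z y ⌋)

  -- τ is defined by recursion on the size of the subtournament; we use a
  -- fuel parameter k (fuel |V(T)|+1 suffices, since the in-neighbourhood
  -- N⁻(y) of y in T[B] is a proper subset of B).
  mutual
    Retentive : ℕ → Subset n → Subset n → Set
    Retentive k B A =
      Nonempty A × A ⊆ B ×
      (∀ x → x ∈ A → Nonempty (inNbr B x) →
         ∀ z → TauMem k (inNbr B x) z → z ∈ A)

    MinRetentive : ℕ → Subset n → Subset n → Set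
    MinRetentive k B A =
      Retentive k B A × (∀ A′ → Retentive k B A′ → ¬ (A′ ⊂ A))

    TauMem : ℕ → Subset n → Fin n → Set
    TauMem zero    B z = ⊥
    TauMem (suc k) B z = ∃[ A ] (MinRetentive k B A × z ∈ A)

  MinimalTauRetentiveIn : Subset n → Subset n → Set
  MinimalTauRetentiveIn B A = MinRetentive n B A

  MinimalTauRetentive : Subset n → Set
  MinimalTauRetentive A = MinimalTauRetentiveIn ⊤ A

  Captain : Subset n → Fin n → Fin n → Set
  Captain R v u =
    v ∈ R × u ∈ R × v ≻ u ×
    (∀ w → w ∈ R → w ≻ u → w ≢ v → v ≻ w)

  DArc : Subset n → Fin n → Fin n → Set
  DArc = Captain

  DomGraphNonempty : Subset n → Set
  DomGraphNonempty R = ∃[ a ] ∃[ b ] (DArc R a b ⊎ DArc R b a)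

-- Let S = N⁻(u). As R is retentive, some minimal τ-retentive set A of T[S]
-- lies inside R. Every vertex of A other than v lies in R and dominates u,
-- so the captain v dominates it; a vertex dominating all other vertices of a
-- minimal τ-retentive set belongs to it, hence v ∈ A. Retentiveness of A now
-- puts into A a vertex z of τ(T[N⁻_S(v)]), which is nonempty because it
-- contains w. Then z ∈ R dominates both u and v, contradicting that v is the
-- captain of u.
module Submission where

open import Defs
open import Data.Nat using (ℕ; zero; suc; _≤_; _<_; s≤s; s≤s⁻¹; z≤n)
open import Data.Nat.Properties using (<-≤-trans; ≤-trans; n≮0)
open import Data.Fin using (_≟_)
open import Data.Fin.Subset using (Subset; _∈_; _∉_; _⊆_; _⊂_; Nonempty; ⊤; ∣_∣)
open import Data.Fin.Subset.Properties using (_∈?_; ∈⊤; ∣p∣≤n; p⊂q⇒∣p∣<∣q∣; x∈p⇒∣p-x∣<∣p∣)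
open import Data.Fin.Subset.Induction using (⊂-wellFounded)
open import Induction.WellFounded using (Acc; acc)
open import Data.Bool.Properties using (T-≡; T-∧)
open import Data.Vec.Properties using (lookup∘tabulate; []=⇒lookup; lookup⇒[]=)
open import Data.Product using (_×_; _,_; ∃-syntax; proj₁; proj₂)
open import Function.Bundles using (Equivalence)
open import Relation.Nullary using (¬_; yes; no)
open import Relation.Nullary.Decidable using (toWitness; fromWitness; ¬¬-excluded-middle)
open import Relation.Binary.PropositionalEquality using (_≢_; refl; trans; sym)

∣p∣≤0⇒x∉p : ∀ {n} {p : Subset n} {x} → ∣ p ∣ ≤ 0 → x ∉ p
∣p∣≤0⇒x∉p ∣p∣≤0 x∈p =
  n≮0 (<-≤-trans (≤-trans (s≤s z≤n) (x∈p⇒∣p-x∣<∣p∣ x∈p)) ∣p∣≤0)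

-- Constructively a ⊂-minimal witness of P exists only up to double negation;
-- this suffices because every goal below is a negation.
¬¬-⊂-minimal : ∀ {n} (P : Subset n → Set) {A} → P A →
  ¬ ¬ (∃[ M ] (P M × (∀ M′ → P M′ → ¬ M′ ⊂ M)))
¬¬-⊂-minimal P {A} pA = go pA (⊂-wellFounded A)
  where
  go : ∀ {A} → P A → Acc _⊂_ A → ¬ ¬ (∃[ M ] (P M × (∀ M′ → P M′ → ¬ M′ ⊂ M)))
  go {A} pA (acc rs) noMinimal =
    ¬¬-excluded-middle {A = ∃[ A′ ] (P A′ × A′ ⊂ A)} λ
      { (yes (A′ , pA′ , A′⊂A)) → go pA′ (rs A′⊂A) noMinimal
      ; (no noSmaller) → noMinimal (A , pA , λ A′ pA′ A′⊂A → noSmaller (A′ , pA′ , A′⊂A))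
      }

module _ {n : ℕ} (T : Tournament n) where
  open Tournament T

  ∈-inNbr⁺ : ∀ {B y z} → z ∈ B → z ≻ y → z ∈ inNbr T B y
  ∈-inNbr⁺ {B} {y} {z} z∈B z≻y =
    lookup⇒[]= z _ (trans (lookup∘tabulate _ z) (Equivalence.to T-≡ (Equivalence.from T-∧
      (fromWitness {a? = z ∈? B} z∈B , fromWitness {a? = ≻-dec z y} z≻y))))

  ∈-inNbr⁻ : ∀ {B y z} → z ∈ inNbr T B y → z ∈ B × z ≻ y
  ∈-inNbr⁻ {B} {y} {z} z∈N =
    let (z∈B? , z≻y?) = Equivalence.to T-∧
          (Equivalence.from T-≡ (trans (sym (lookup∘tabulate _ z)) ([]=⇒lookup z∈N)))
    in toWitness {a? = z ∈? B} z∈B? , toWitness {a? = ≻-dec z y} z≻y?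

  inNbr-⊆ : ∀ {B y} → inNbr T B y ⊆ B
  inNbr-⊆ z∈N = proj₁ (∈-inNbr⁻ z∈N)

  ∣inNbr∣<∣B∣ : ∀ {B y} → y ∈ B → ∣ inNbr T B y ∣ < ∣ B ∣
  ∣inNbr∣<∣B∣ {B} {y} y∈B = p⊂q⇒∣p∣<∣q∣ (inNbr-⊆ , y , y∈B , y∉inNbr)
    where
    y∉inNbr : y ∉ inNbr T B y
    y∉inNbr y∈N = let y≻y = proj₂ (∈-inNbr⁻ y∈N) in asym y≻y y≻y

  ∣inNbr∣≤pred : ∀ {B y k} → ∣ B ∣ ≤ suc k → y ∈ B → ∣ inNbr T B y ∣ ≤ k
  ∣inNbr∣≤pred ∣B∣≤1+k y∈B = s≤s⁻¹ (<-≤-trans (∣inNbr∣<∣B∣ y∈B) ∣B∣≤1+k)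

  τ-⊆ : ∀ k {B z} → TauMem T k B z → z ∈ B
  τ-⊆ (suc k) (A , ((_ , A⊆B , _) , _) , z∈A) = A⊆B z∈A

  whole-retentive : ∀ k {B} → Nonempty B → Retentive T k B B
  whole-retentive k nonempty = nonempty , (λ z∈B → z∈B) , λ _ _ _ _ z∈τ → inNbr-⊆ (τ-⊆ k z∈τ)

  ¬¬-minRetentive : ∀ k {B} → Nonempty B → ¬ ¬ (∃[ A ] MinRetentive T k B A)
  ¬¬-minRetentive k nonempty = ¬¬-⊂-minimal (Retentive T k _) (whole-retentive k nonempty)

  minRetentive-below : ∀ k {B A x} → Retentive T (suc k) B A → x ∈ A →
    Nonempty (inNbr T B x) →
    ¬ ¬ (∃[ A′ ] (MinRetentive T k (inNbr T B x) A′ × A′ ⊆ A))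
  minRetentive-below k (_ , _ , retentive) x∈A nonempty noA′ =
    ¬¬-minRetentive k nonempty λ (A′ , minA′) →
      noA′ (A′ , minA′ , λ z∈A′ → retentive _ x∈A nonempty _ (A′ , minA′ , z∈A′))

  -- With fuel 0, TauMem is empty and retentiveness vacuous; the bound ∣ B ∣ ≤ k
  -- rules this case out for nonempty B.
  retentive-∋-inNeighbour : ∀ k {B A x} → ∣ B ∣ ≤ k → Retentive T k B A → x ∈ A →
    Nonempty (inNbr T B x) → ¬ ¬ (∃[ z ] (z ∈ A × z ∈ inNbr T B x))
  retentive-∋-inNeighbour zero ∣B∣≤0 (_ , A⊆B , _) x∈A _ =
    λ _ → ∣p∣≤0⇒x∉p ∣B∣≤0 (A⊆B x∈A)
  retentive-∋-inNeighbour (suc k) _ retA x∈A nonempty noZ =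
    minRetentive-below k retA x∈A nonempty
      λ (A′ , (((z , z∈A′) , A′⊆N , _) , _) , A′⊆A) → noZ (z , A′⊆A z∈A′ , A′⊆N z∈A′)

  -- If x ∈ A is not v, then v ≻ x puts v into N⁻(x), so some minimal
  -- τ-retentive set of the smaller tournament T[N⁻(x)] lies in A and the
  -- hypothesis descends to it.
  dominator∈minRetentive : ∀ k {B A v} → ∣ B ∣ ≤ k → v ∈ B → MinRetentive T k B A →
    (∀ y → y ∈ A → y ≢ v → v ≻ y) → ¬ ¬ (v ∈ A)
  dominator∈minRetentive zero ∣B∣≤0 v∈B _ _ = λ _ → ∣p∣≤0⇒x∉p ∣B∣≤0 v∈B
  dominator∈minRetentive (suc k) {B} {v = v} ∣B∣≤1+k v∈B
    minA@(((x , x∈A) , A⊆B , _) , _) dominates v∉A with x ≟ v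
  ... | yes refl = v∉A x∈A
  ... | no x≢v = minRetentive-below k (proj₁ minA) x∈A (v , v∈N)
    λ (A′ , minA′ , A′⊆A) →
      dominator∈minRetentive k (∣inNbr∣≤pred ∣B∣≤1+k (A⊆B x∈A)) v∈N minA′
        (λ y y∈A′ → dominates y (A′⊆A y∈A′)) (λ v∈A′ → v∉A (A′⊆A v∈A′))
    where
    v∈N : v ∈ inNbr T B x
    v∈N = ∈-inNbr⁺ v∈B (dominates x x∈A x≢v)

  captain-has-no-common-dominator : ∀ k {B R v u w} → ∣ B ∣ ≤ k → Retentive T k B R →
    Captain T R v u → w ∈ B → ¬ (w ≻ v × w ≻ u)
  captain-has-no-common-dominator zero ∣B∣≤0 (_ , R⊆B , _) (v∈R , _) _ _ =
    ∣p∣≤0⇒x∉p ∣B∣≤0 (R⊆B v∈R)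
  captain-has-no-common-dominator (suc k) {B} {v = v} {u} {w} ∣B∣≤1+k retR@(_ , R⊆B , _)
    (v∈R , u∈R , v≻u , captain) w∈B (w≻v , w≻u) =
    minRetentive-below k retR u∈R (v , v∈S) λ (A , minA , A⊆R) →
    dominator∈minRetentive k ∣S∣≤k v∈S minA
      (λ y y∈A → captain y (A⊆R y∈A) (≻u (A⊆S minA y∈A))) λ v∈A →
    retentive-∋-inNeighbour k ∣S∣≤k (proj₁ minA) v∈A (w , ∈-inNbr⁺ (∈-inNbr⁺ w∈B w≻u) w≻v)
      λ (z , z∈A , z∈N) →
        let z≻v = proj₂ (∈-inNbr⁻ z∈N) in
        asym z≻v (captain z (A⊆R z∈A) (≻u (proj₁ (∈-inNbr⁻ z∈N)))
          λ { refl → asym z≻v z≻v })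
    where
    v∈S : v ∈ inNbr T B u
    v∈S = ∈-inNbr⁺ (R⊆B v∈R) v≻u
    ∣S∣≤k : ∣ inNbr T B u ∣ ≤ k
    ∣S∣≤k = ∣inNbr∣≤pred ∣B∣≤1+k (R⊆B u∈R)
    ≻u : ∀ {z} → z ∈ inNbr T B u → z ≻ u
    ≻u z∈S = proj₂ (∈-inNbr⁻ z∈S)
    A⊆S : ∀ {A} → MinRetentive T k (inNbr T B u) A → A ⊆ inNbr T B u
    A⊆S ((_ , A⊆N , _) , _) = A⊆N

lemma13 : ∀ {n} (T : Tournament n) (R : Subset n) →
    MinimalTauRetentive T R → DomGraphNonempty T R →
    ∀ v u → DArc T R v u →
    ∀ w → ¬ (Tournament._≻_ T w v × Tournament._≻_ T w u)
lemma13 {n} T R (retR , _) _ v u captain w =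
  captain-has-no-common-dominator T n (∣p∣≤n ⊤) retR captain ∈⊤
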